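{- Let $G$ be a graph of girth $g\in\{5,6\}$ and minimum degree $\delta\geq 2$. Then $$Z(G)\geq (g-2)(\delta-2)+2.$$
   Context: All graphs are finite, simple and undirected; the girth is the length of a shortest cycle. For a set $Z\subseteq V(G)$, let $\mathcal{F}(Z)$ be the set obtained from $Z$ by repeatedly adding a vertex $u$ outside the current set whenever $u$ is the unique neighbor outside the current set of some vertex in the current set, as long as possible. $Z$ is a zero forcing set of $G$ if $\mathcal{F}(Z)=V(G)$. The zero forcing number $Z(G)$ is the minimum cardinality of a zero forcing set of $G$. -}

module Defs where

open import Data.Nat using (ℕ; zero; suc; _≤_; _+_)
open import Data.Bool using (Bool; true; false)
open import Data.Fin using (Fin; toℕ)
open import Data.Fin.Subset using (Subset; _∈_; ∣_∣)
open import Data.Vec using (tabulate)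
open import Data.Product using (Σ; ∃; _×_)
open import Relation.Binary.PropositionalEquality using (_≡_; _≢_)

record Graph : Set where
  field
    n      : ℕ
    adj    : Fin n → Fin n → Bool
    sym    : ∀ u v → adj u v ≡ adj v u
    irrefl : ∀ v → adj v v ≡ false

open Graph public

Adj : (G : Graph) → Fin (n G) → Fin (n G) → Set
Adj G u v = adj G u v ≡ true

degree : (G : Graph) → Fin (n G) → ℕ
degree G v = ∣ tabulate (adj G v) ∣

IsMinDegree : Graph → ℕ → Set
IsMinDegree G δ = (∀ v → δ ≤ degree G v) × (∃ λ v → degree G v ≡ δ)

record Cycle (G : Graph) (k : ℕ) : Set where
  field
    three≤k : 3 ≤ k
    walk    : Fin k → Fin (n G)
    inj     : ∀ i j → walk i ≡ walk j → i ≡ j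
    step    : ∀ i j → suc (toℕ i) ≡ toℕ j → Adj G (walk i) (walk j)
    close   : ∀ i j → suc (toℕ i) ≡ k → toℕ j ≡ 0 → Adj G (walk i) (walk j)

HasGirth : Graph → ℕ → Set
HasGirth G g = Cycle G g × (∀ k → suc k ≤ g → Cycle G k → Data.Empty.⊥)
  where import Data.Empty

-- F(Z): the closure of Z under the forcing rule.
-- Since the rule is monotone, F(Z) is the least set containing Z closed under it.
data InClosure (G : Graph) (Z : Subset (n G)) : Fin (n G) → Set where
  base  : ∀ {u} → u ∈ Z → InClosure G Z u
  force : ∀ {u} v → InClosure G Z v → Adj G v u
        → (∀ w → Adj G v w → w ≢ u → InClosure G Z w)
        → InClosure G Z u

IsZeroForcingSet : (G : Graph) → Subset (n G) → Set
IsZeroForcingSet G Z = ∀ u → InClosure G Z u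

ZeroForcingNumber≥ : Graph → ℕ → Set
ZeroForcingNumber≥ G k = ∀ (Z : Subset (n G)) → IsZeroForcingSet G Z → k ≤ ∣ Z ∣

-- Let Z be a zero forcing set and k = g − 2. Run the forcing process from Z for k steps. A vertex
-- that forces has its whole closed neighbourhood N[x] inside Z plus the vertices forced so far, so
-- the k forcing vertices x₁, …, xₖ (or, if everything is forced sooner, any k vertices of a
-- shortest cycle) satisfy |N[x₁] ∪ ⋯ ∪ N[xₖ]| ≤ |Z| + k. On the other hand |N[xᵢ]| ≥ δ + 1, and
-- since there are no cycles shorter than g = k + 2, inclusion–exclusion shows that these k closed
-- neighbourhoods overlap in at most 2(k − 1) vertices: two of them share at most two vertices (one
-- if the centres are nonadjacent), and the remaining corrections are determined by the forest
-- that G induces on {x₁, …, xₖ}. Hence k(δ + 1) − 2(k − 1) ≤ |Z| + k, i.e. |Z| ≥ k(δ − 2) + 2.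

module Submission where

open import Defs hiding (sym)

open import Data.Bool using (Bool; true; false; _∧_; _∨_)
open import Data.Bool.ListAction using (or; any)
open import Data.Bool.Properties using (∨-zeroʳ; not-¬) renaming (_≟_ to _≟ᵇ_)
open import Data.Empty using (⊥; ⊥-elim)
open import Data.Fin using (Fin; zero; suc; toℕ; fromℕ; _≟_)
open import Data.Fin.Properties using (toℕ-injective; toℕ-fromℕ; suc-injective; any?; all?; ¬∀⟶∃¬)
open import Data.Fin.Subset using (Subset; _∈_; _∉_; _⊆_; _∪_; ⁅_⁆; ∣_∣)
open import Data.Fin.Subset.Properties using (_∈?_; x∈⁅x⁆; x∈p∪q⁺; p⊆p∪q; ∣⁅x⁆∣≡1)
open import Data.List using (List; []; _∷_; length; map; lookup; drop; tabulate)
import Data.List as L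
open import Data.List.Membership.Propositional.Properties using (∈-lookup)
open import Data.List.Relation.Binary.Permutation.Propositional as ↭ using (_↭_; prep; swap; ↭-sym; ↭⇒↭ₛ)
open import Data.List.Relation.Binary.Permutation.Propositional.Properties using (map⁺; shifts)
import Data.List.Relation.Binary.Permutation.Setoid.Properties as ↭ₛ
open import Data.List.Relation.Unary.All as All using (All; []; _∷_)
open import Data.List.Relation.Unary.AllPairs using ([]; _∷_)
open import Data.List.Relation.Unary.Linked using (Linked; [-]; _∷_)
open import Data.List.Relation.Unary.Unique.Propositional using (Unique)
open import Data.List.Relation.Unary.Unique.Propositional.Properties using (drop⁺; tabulate⁺)
open import Data.Nat using (ℕ; zero; suc; _+_; _*_; _∸_; _≤_; z≤n; s≤s)
open import Data.Nat.ListAction using (sum)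
open import Data.Nat.ListAction.Properties using (sum-↭)
import Data.Nat.Properties as Nat
open import Data.Nat.Properties
  using (≤-refl; ≤-reflexive; ≤-trans; module ≤-Reasoning; +-mono-≤; +-monoʳ-≤; +-monoˡ-≤; m≤m+n; m≤n+m;
         n≤1+n; +-identityʳ; +-suc; +-assoc; +-cancelʳ-≤; +-0-commutativeMonoid; ≤ᵇ⇒≤)
open import Data.Nat.Tactic.RingSolver using (solve; solve-∀)
open import Data.Product using (Σ; ∃; ∃₂; _×_; _,_; proj₁; proj₂)
open import Data.Sum as ⊎ using (_⊎_; inj₁; inj₂)
open import Data.Unit using (tt)
import Data.Vec as Vec
open import Data.Vec.Properties using (lookup-zipWith; lookup∘tabulate; []=⇒lookup)
open import Function using (_∘_; id; case_of_)
open import Relation.Binary.PropositionalEquality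
open import Relation.Binary.PropositionalEquality.Properties using (setoid)
open import Relation.Nullary using (¬_; yes; no; does; ¬?)
open import Relation.Nullary.Decidable using (dec-true; decidable-stable; _×-dec_)
open import Relation.Nullary.Negation using (contradiction)

open import Algebra.Properties.CommutativeMonoid.Sum +-0-commutativeMonoid
  using (sum-syntax; ∑-distrib-+; sum-cong-≗; sum-replicate-zero)
  renaming (sum to ∑)

∧-true⁻ : ∀ {a b} → a ∧ b ≡ true → a ≡ true × b ≡ true
∧-true⁻ {true}  b≡true = refl , b≡true
∧-true⁻ {false} ()

∧-true⁺ : ∀ {a b} → a ≡ true → b ≡ true → a ∧ b ≡ true
∧-true⁺ refl refl = refl

does-≟⇒≡ : ∀ {m} {i j : Fin m} → does (i ≟ j) ≡ true → i ≡ j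
does-≟⇒≡ {i = i} {j} h with i ≟ j
... | yes i≡j = i≡j

indicator : Bool → ℕ
indicator true  = 1
indicator false = 0

count : ∀ {m} → (Fin m → Bool) → ℕ
count {m} p = ∑[ i < m ] indicator (p i)

∑-mono-≤ : ∀ {m} {f g : Fin m → ℕ} → (∀ i → f i ≤ g i) → ∑ f ≤ ∑ g
∑-mono-≤ {zero}  f≤g = z≤n
∑-mono-≤ {suc m} f≤g = +-mono-≤ (f≤g zero) (∑-mono-≤ (λ i → f≤g (suc i)))

sum-map-count : ∀ {m} (ps : List (Fin m → Bool)) →
                sum (map count ps) ≡ ∑[ i < m ] sum (map (λ p → indicator (p i)) ps)
sum-map-count {m} []       = sym (sum-replicate-zero m)
sum-map-count     (p ∷ ps) = trans (cong (count p +_) (sum-map-count ps))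
                                   (sym (∑-distrib-+ (λ i → indicator (p i)) _))

count-sum-mono : ∀ {m} (ps qs : List (Fin m → Bool)) →
                 (∀ i → sum (map (λ p → indicator (p i)) ps) ≤ sum (map (λ q → indicator (q i)) qs)) →
                 sum (map count ps) ≤ sum (map count qs)
count-sum-mono ps qs pointwise = begin
  sum (map count ps)  ≡⟨ sum-map-count ps ⟩
  _                   ≤⟨ ∑-mono-≤ pointwise ⟩
  _                   ≡⟨ sum-map-count qs ⟨
  sum (map count qs)  ∎
  where open ≤-Reasoning

count-cong : ∀ {m} {p q : Fin m → Bool} → (∀ i → p i ≡ q i) → count p ≡ count q
count-cong p≗q = sum-cong-≗ (λ i → cong indicator (p≗q i))

count-mono : ∀ {m} {p q : Fin m → Bool} → (∀ i → p i ≡ true → q i ≡ true) → count p ≤ count q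
count-mono p⊆q = ∑-mono-≤ (λ i → indicator-mono (p⊆q i))
  where
  indicator-mono : ∀ {a b} → (a ≡ true → b ≡ true) → indicator a ≤ indicator b
  indicator-mono {false} _   = z≤n
  indicator-mono {true}  a⇒b rewrite a⇒b refl = ≤-refl

count-≡0 : ∀ {m} {p : Fin m → Bool} → (∀ i → p i ≢ true) → count p ≡ 0
count-≡0 {zero}          none = refl
count-≡0 {suc m} {p = p} none with p zero in p₀
... | true  = contradiction p₀ (none zero)
... | false = count-≡0 (λ i → none (suc i))

count-pos : ∀ {m} {p : Fin m → Bool} i → p i ≡ true → 1 ≤ count p
count-pos {p = p} zero    p₀ = ≤-trans (≤-reflexive (sym (cong indicator p₀))) (m≤m+n (indicator (p zero)) _)
count-pos {p = p} (suc i) pᵢ = ≤-trans (count-pos i pᵢ) (m≤n+m _ (indicator (p zero)))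

count-zero-or-witness : ∀ {m} (p : Fin m → Bool) → count p ≡ 0 ⊎ ∃ λ i → p i ≡ true
count-zero-or-witness p with any? (λ i → p i ≟ᵇ true)
... | yes witness = inj₂ witness
... | no  none    = inj₁ (count-≡0 (λ i pᵢ → none (i , pᵢ)))

count-≤1 : ∀ {m} {p : Fin m → Bool} → (∀ i j → p i ≡ true → p j ≡ true → i ≡ j) → count p ≤ 1
count-≤1 {zero}          _      = z≤n
count-≤1 {suc m} {p = p} unique with p zero in p₀
... | true  = ≤-reflexive (cong suc (count-≡0 (λ i pᵢ → case unique zero (suc i) p₀ pᵢ of λ ())))
... | false = count-≤1 (λ i j pᵢ pⱼ → suc-injective (unique (suc i) (suc j) pᵢ pⱼ))

count-singleton≤1 : ∀ {m} (a : Fin m) → count (λ i → does (i ≟ a)) ≤ 1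
count-singleton≤1 a = count-≤1 both-a
  where
  both-a : ∀ i j → does (i ≟ a) ≡ true → does (j ≟ a) ≡ true → i ≡ j
  both-a i j i≡a j≡a = trans (does-≟⇒≡ i≡a) (sym (does-≟⇒≡ j≡a))

count-∪-≤ : ∀ {m} {p q r : Fin m → Bool} → (∀ i → p i ≡ true → q i ≡ true ⊎ r i ≡ true) →
            count p ≤ count q + count r
count-∪-≤ {m} {p} {q} {r} cover = begin
  count p                                        ≤⟨ ∑-mono-≤ (λ i → indicator-∪ (cover i)) ⟩
  ∑[ i < m ] (indicator (q i) + indicator (r i)) ≡⟨ ∑-distrib-+ (λ i → indicator (q i)) (λ i → indicator (r i)) ⟩
  count q + count r                              ∎
  where
  open ≤-Reasoning
  indicator-∪ : ∀ {a b c} → (a ≡ true → b ≡ true ⊎ c ≡ true) → indicator a ≤ indicator b + indicator c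
  indicator-∪ {false}     _ = z≤n
  indicator-∪ {true}  {b} a⇒b∨c with a⇒b∨c refl
  ... | inj₁ refl = s≤s z≤n
  ... | inj₂ refl = m≤n+m 1 (indicator b)

count-disjoint-∪ : ∀ {m} {p q : Fin m → Bool} → (∀ i → p i ≡ true → q i ≢ true) →
                   count p + count q ≤ count (λ i → p i ∨ q i)
count-disjoint-∪ {m} {p} {q} apart = begin
  count p + count q                              ≡⟨ ∑-distrib-+ (λ i → indicator (p i)) (λ i → indicator (q i)) ⟨
  ∑[ i < m ] (indicator (p i) + indicator (q i)) ≤⟨ ∑-mono-≤ (λ i → indicator-disjoint (apart i)) ⟩
  count (λ i → p i ∨ q i)                        ∎
  where
  open ≤-Reasoning
  indicator-disjoint : ∀ {a b} → (a ≡ true → b ≢ true) → indicator a + indicator b ≤ indicator (a ∨ b)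
  indicator-disjoint {true}  {true}  a⇒¬b = contradiction refl (a⇒¬b refl)
  indicator-disjoint {true}  {false} _    = ≤-refl
  indicator-disjoint {false}         _    = ≤-refl

count-≤2 : ∀ {m} {p : Fin m → Bool} (a b : Fin m) → (∀ i → p i ≡ true → i ≡ a ⊎ i ≡ b) → count p ≤ 2
count-≤2 {p = p} a b cover = ≤-trans (count-∪-≤ a-or-b) (+-mono-≤ (count-singleton≤1 a) (count-singleton≤1 b))
  where
  a-or-b : ∀ i → p i ≡ true → does (i ≟ a) ≡ true ⊎ does (i ≟ b) ≡ true
  a-or-b i pᵢ = ⊎.map (dec-true (i ≟ a)) (dec-true (i ≟ b)) (cover i pᵢ)

count-+-≤1 : ∀ {m} {p q : Fin m → Bool} → count p ≤ 1 → count q ≤ 1 →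
             (∀ i j → p i ≡ true → q j ≡ true → ⊥) → count p + count q ≤ 1
count-+-≤1 {p = p} {q} p≤1 q≤1 apart with count-zero-or-witness p | count-zero-or-witness q
... | inj₁ p≡0      | _             rewrite p≡0 = q≤1
... | inj₂ _        | inj₁ q≡0      rewrite q≡0 | +-identityʳ (count p) = p≤1
... | inj₂ (i , pᵢ) | inj₂ (j , qⱼ) = ⊥-elim (apart i j pᵢ qⱼ)

∣p∣≡count : ∀ {m} (p : Subset m) → ∣ p ∣ ≡ count (Vec.lookup p)
∣p∣≡count Vec.[]          = refl
∣p∣≡count (true  Vec.∷ p) = cong suc (∣p∣≡count p)
∣p∣≡count (false Vec.∷ p) = ∣p∣≡count p

∣p∪q∣≤∣p∣+∣q∣ : ∀ {m} (p q : Subset m) → ∣ p ∪ q ∣ ≤ ∣ p ∣ + ∣ q ∣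
∣p∪q∣≤∣p∣+∣q∣ p q = begin
  ∣ p ∪ q ∣                                   ≡⟨ ∣p∣≡count (p ∪ q) ⟩
  count (Vec.lookup (p ∪ q))                  ≤⟨ count-∪-≤ split ⟩
  count (Vec.lookup p) + count (Vec.lookup q) ≡⟨ cong₂ _+_ (∣p∣≡count p) (∣p∣≡count q) ⟨
  ∣ p ∣ + ∣ q ∣                               ∎
  where
  open ≤-Reasoning
  split : ∀ i → Vec.lookup (p ∪ q) i ≡ true → Vec.lookup p i ≡ true ⊎ Vec.lookup q i ≡ true
  split i h with Vec.lookup p i | lookup-zipWith _∨_ i p q
  ... | true  | _ = inj₁ refl
  ... | false | e = inj₂ (trans (sym e) h)

count≤∣S∣ : ∀ {m} {p : Fin m → Bool} (S : Subset m) → (∀ i → p i ≡ true → i ∈ S) → count p ≤ ∣ S ∣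
count≤∣S∣ S p⊆S = ≤-trans (count-mono (λ i pᵢ → []=⇒lookup (p⊆S i pᵢ))) (≤-reflexive (sym (∣p∣≡count S)))

+-mono₃-≤ : ∀ {a b c x y z} → a ≤ x → b ≤ y → c ≤ z → a + b + c ≤ x + y + z
+-mono₃-≤ a≤x b≤y c≤z = +-mono-≤ (+-mono-≤ a≤x b≤y) c≤z

+-mono₆-≤ : ∀ {a b c d e f x y z u v w} → a ≤ x → b ≤ y → c ≤ z → d ≤ u → e ≤ v → f ≤ w →
            a + b + c + d + e + f ≤ x + y + z + u + v + w
+-mono₆-≤ a≤x b≤y c≤z d≤u e≤v f≤w = +-mono-≤ (+-mono-≤ (+-mono-≤ (+-mono₃-≤ a≤x b≤y c≤z) d≤u) e≤v) f≤w

absorb₃ : ∀ n₁ n₂ n₃ t u p₁ p₂ p₃ ℓ →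
  n₁ + (n₂ + (n₃ + (t + 0))) ≤ u + (p₁ + (p₂ + (p₃ + 0))) → p₁ + p₂ + p₃ ≤ ℓ + t →
  n₁ + (n₂ + (n₃ + 0)) ≤ u + ℓ
absorb₃ n₁ n₂ n₃ t u p₁ p₂ p₃ ℓ ie pairs≤ = +-cancelʳ-≤ t _ _ (begin
  n₁ + (n₂ + (n₃ + 0)) + t    ≡⟨ solve (n₁ L.∷ n₂ L.∷ n₃ L.∷ t L.∷ L.[]) ⟩
  n₁ + (n₂ + (n₃ + (t + 0)))  ≤⟨ ie ⟩
  u + (p₁ + (p₂ + (p₃ + 0)))  ≡⟨ solve (u L.∷ p₁ L.∷ p₂ L.∷ p₃ L.∷ L.[]) ⟩
  u + (p₁ + p₂ + p₃)          ≤⟨ +-monoʳ-≤ u pairs≤ ⟩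
  u + (ℓ + t)                 ≡⟨ +-assoc u ℓ t ⟨
  u + ℓ + t                   ∎)
  where open ≤-Reasoning

absorb₄ : ∀ n₁ n₂ n₃ n₄ t₁ t₂ t₃ t₄ u p₁ p₂ p₃ p₄ p₅ p₆ q ℓ →
  n₁ + (n₂ + (n₃ + (n₄ + (t₁ + (t₂ + (t₃ + (t₄ + 0))))))) ≤
    u + (p₁ + (p₂ + (p₃ + (p₄ + (p₅ + (p₆ + (q + 0))))))) →
  p₁ + p₂ + p₃ + p₄ + p₅ + p₆ + q ≤ ℓ + (t₁ + t₂ + t₃ + t₄) →
  n₁ + (n₂ + (n₃ + (n₄ + 0))) ≤ u + ℓ
absorb₄ n₁ n₂ n₃ n₄ t₁ t₂ t₃ t₄ u p₁ p₂ p₃ p₄ p₅ p₆ q ℓ ie core = +-cancelʳ-≤ t _ _ (begin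
  n₁ + (n₂ + (n₃ + (n₄ + 0))) + (t₁ + t₂ + t₃ + t₄)
    ≡⟨ solve (n₁ L.∷ n₂ L.∷ n₃ L.∷ n₄ L.∷ t₁ L.∷ t₂ L.∷ t₃ L.∷ t₄ L.∷ L.[]) ⟩
  n₁ + (n₂ + (n₃ + (n₄ + (t₁ + (t₂ + (t₃ + (t₄ + 0)))))))
    ≤⟨ ie ⟩
  u + (p₁ + (p₂ + (p₃ + (p₄ + (p₅ + (p₆ + (q + 0)))))))
    ≡⟨ solve (u L.∷ p₁ L.∷ p₂ L.∷ p₃ L.∷ p₄ L.∷ p₅ L.∷ p₆ L.∷ q L.∷ L.[]) ⟩
  u + (p₁ + p₂ + p₃ + p₄ + p₅ + p₆ + q)
    ≤⟨ +-monoʳ-≤ u core ⟩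
  u + (ℓ + t)
    ≡⟨ +-assoc u ℓ t ⟨
  u + ℓ + t ∎)
  where
  open ≤-Reasoning
  t = t₁ + t₂ + t₃ + t₄

absorb-first : ∀ {P Q ℓ} T₁ T₂ T₃ T₄ → P ≤ ℓ + (T₂ + T₃ + T₄) → Q ≤ T₁ → P + Q ≤ ℓ + (T₁ + T₂ + T₃ + T₄)
absorb-first {P} {Q} {ℓ} T₁ T₂ T₃ T₄ P≤ Q≤T₁ = begin
  P + Q                    ≤⟨ +-mono-≤ P≤ Q≤T₁ ⟩
  ℓ + (T₂ + T₃ + T₄) + T₁  ≡⟨ solve (ℓ L.∷ T₁ L.∷ T₂ L.∷ T₃ L.∷ T₄ L.∷ L.[]) ⟩
  ℓ + (T₁ + T₂ + T₃ + T₄)  ∎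
  where open ≤-Reasoning

absorb-second : ∀ {P Q ℓ} T₁ T₂ T₃ T₄ → P ≤ ℓ + (T₁ + T₃ + T₄) → Q ≤ T₂ → P + Q ≤ ℓ + (T₁ + T₂ + T₃ + T₄)
absorb-second {P} {Q} {ℓ} T₁ T₂ T₃ T₄ P≤ Q≤T₂ = begin
  P + Q                    ≤⟨ +-mono-≤ P≤ Q≤T₂ ⟩
  ℓ + (T₁ + T₃ + T₄) + T₂  ≡⟨ solve (ℓ L.∷ T₁ L.∷ T₂ L.∷ T₃ L.∷ T₄ L.∷ L.[]) ⟩
  ℓ + (T₁ + T₂ + T₃ + T₄)  ∎
  where open ≤-Reasoning

length*≤sum : ∀ {A : Set} {f : A → ℕ} {c} xs → (∀ x → c ≤ f x) → length xs * c ≤ sum (map f xs)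
length*≤sum []       _   = z≤n
length*≤sum (x ∷ xs) c≤f = +-mono-≤ (c≤f x) (length*≤sum xs c≤f)

bound-from-counts : ∀ j d z → suc j * (3 + d) ≤ suc j + z + 2 * j → suc j * d + 2 ≤ z
bound-from-counts j d z counts = +-cancelʳ-≤ (suc j + 2 * j) (suc j * d + 2) z (begin
  suc j * d + 2 + (suc j + 2 * j)  ≡⟨ solve (j L.∷ d L.∷ L.[]) ⟩
  suc j * (3 + d)                  ≤⟨ counts ⟩
  suc j + z + 2 * j                ≡⟨ solve (j L.∷ z L.∷ L.[]) ⟩
  z + (suc j + 2 * j)              ∎)
  where open ≤-Reasoning

-- Inclusion–exclusion

-- If the first membership is false the statement is the one for the remaining sets; if it is true,
-- both sides are the same sum.

pointwise-ie₁ : ∀ p → indicator p + 0 ≤ indicator (or (p ∷ [])) + 0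
pointwise-ie₁ true  = ≤-refl
pointwise-ie₁ false = ≤-refl

pointwise-ie₂ : ∀ p q → indicator p + (indicator q + 0) ≤ indicator (or (p ∷ q ∷ [])) + (indicator (p ∧ q) + 0)
pointwise-ie₂ true  q = ≤-refl
pointwise-ie₂ false q = pointwise-ie₁ q

pointwise-ie₃ : ∀ p q r →
  indicator p + (indicator q + (indicator r + (indicator (p ∧ q ∧ r) + 0))) ≤
  indicator (or (p ∷ q ∷ r ∷ [])) + (indicator (p ∧ q) + (indicator (p ∧ r) + (indicator (q ∧ r) + 0)))
pointwise-ie₃ true  q r = ≤-refl
pointwise-ie₃ false q r = pointwise-ie₂ q r

pointwise-ie₄ : ∀ p q r s →
  indicator p + (indicator q + (indicator r + (indicator s +
    (indicator (p ∧ q ∧ r) + (indicator (p ∧ q ∧ s) + (indicator (p ∧ r ∧ s) + (indicator (q ∧ r ∧ s) + 0))))))) ≤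
  indicator (or (p ∷ q ∷ r ∷ s ∷ [])) + (indicator (p ∧ q) + (indicator (p ∧ r) + (indicator (p ∧ s) +
    (indicator (q ∧ r) + (indicator (q ∧ s) + (indicator (r ∧ s) + (indicator (p ∧ q ∧ r ∧ s) + 0)))))))
pointwise-ie₄ true  q r s = ≤-refl
pointwise-ie₄ false q r s = pointwise-ie₃ q r s

inclusion–exclusion₃ : ∀ {m} (p q r : Fin m → Bool) →
  sum (map count (p ∷ q ∷ r ∷ (λ i → p i ∧ q i ∧ r i) ∷ [])) ≤
  sum (map count ((λ i → or (p i ∷ q i ∷ r i ∷ [])) ∷
                  (λ i → p i ∧ q i) ∷ (λ i → p i ∧ r i) ∷ (λ i → q i ∧ r i) ∷ []))
inclusion–exclusion₃ p q r =
  count-sum-mono (p ∷ q ∷ r ∷ _ ∷ []) (_ ∷ _ ∷ _ ∷ _ ∷ []) (λ i → pointwise-ie₃ (p i) (q i) (r i))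

inclusion–exclusion₄ : ∀ {m} (p q r s : Fin m → Bool) →
  sum (map count (p ∷ q ∷ r ∷ s ∷ (λ i → p i ∧ q i ∧ r i) ∷ (λ i → p i ∧ q i ∧ s i) ∷
                  (λ i → p i ∧ r i ∧ s i) ∷ (λ i → q i ∧ r i ∧ s i) ∷ [])) ≤
  sum (map count ((λ i → or (p i ∷ q i ∷ r i ∷ s i ∷ [])) ∷
                  (λ i → p i ∧ q i) ∷ (λ i → p i ∧ r i) ∷ (λ i → p i ∧ s i) ∷
                  (λ i → q i ∧ r i) ∷ (λ i → q i ∧ s i) ∷ (λ i → r i ∧ s i) ∷
                  (λ i → p i ∧ q i ∧ r i ∧ s i) ∷ []))
inclusion–exclusion₄ p q r s =
  count-sum-mono (p ∷ q ∷ r ∷ s ∷ _ ∷ _ ∷ _ ∷ _ ∷ []) (_ ∷ _ ∷ _ ∷ _ ∷ _ ∷ _ ∷ _ ∷ _ ∷ [])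
                 (λ i → pointwise-ie₄ (p i) (q i) (r i) (s i))

count-⋃₃ : ∀ {m} (p q r : Fin m → Bool) ℓ →
  count (λ i → p i ∧ q i) + count (λ i → p i ∧ r i) + count (λ i → q i ∧ r i) ≤
    ℓ + count (λ i → p i ∧ q i ∧ r i) →
  sum (map count (p ∷ q ∷ r ∷ [])) ≤ count (λ i → or (p i ∷ q i ∷ r i ∷ [])) + ℓ
count-⋃₃ p q r ℓ = absorb₃ (count p) (count q) (count r) (count (λ i → p i ∧ q i ∧ r i))
  (count (λ i → or (p i ∷ q i ∷ r i ∷ [])))
  (count (λ i → p i ∧ q i)) (count (λ i → p i ∧ r i)) (count (λ i → q i ∧ r i)) ℓ
  (inclusion–exclusion₃ p q r)

count-⋃₄ : ∀ {m} (p q r s : Fin m → Bool) ℓ →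
  count (λ i → p i ∧ q i) + count (λ i → p i ∧ r i) + count (λ i → p i ∧ s i) +
    count (λ i → q i ∧ r i) + count (λ i → q i ∧ s i) + count (λ i → r i ∧ s i) +
    count (λ i → p i ∧ q i ∧ r i ∧ s i) ≤
  ℓ + (count (λ i → p i ∧ q i ∧ r i) + count (λ i → p i ∧ q i ∧ s i) +
       count (λ i → p i ∧ r i ∧ s i) + count (λ i → q i ∧ r i ∧ s i)) →
  sum (map count (p ∷ q ∷ r ∷ s ∷ [])) ≤ count (λ i → or (p i ∷ q i ∷ r i ∷ s i ∷ [])) + ℓ
count-⋃₄ p q r s ℓ = absorb₄ (count p) (count q) (count r) (count s)
  (count (λ i → p i ∧ q i ∧ r i)) (count (λ i → p i ∧ q i ∧ s i))
  (count (λ i → p i ∧ r i ∧ s i)) (count (λ i → q i ∧ r i ∧ s i))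
  (count (λ i → or (p i ∷ q i ∷ r i ∷ s i ∷ [])))
  (count (λ i → p i ∧ q i)) (count (λ i → p i ∧ r i)) (count (λ i → p i ∧ s i))
  (count (λ i → q i ∧ r i)) (count (λ i → q i ∧ s i)) (count (λ i → r i ∧ s i))
  (count (λ i → p i ∧ q i ∧ r i ∧ s i)) ℓ
  (inclusion–exclusion₄ p q r s)

pattern distinct₃ ab ac bc = (ab ∷ ac ∷ []) ∷ (bc ∷ []) ∷ [] ∷ []
pattern distinct₄ ab ac ad bc bd cd = (ab ∷ ac ∷ ad ∷ []) ∷ (bc ∷ bd ∷ []) ∷ (cd ∷ []) ∷ [] ∷ []

unique-↭ : ∀ {A : Set} {xs ys : List A} → xs ↭ ys → Unique xs → Unique ys
unique-↭ {A} σ = ↭ₛ.Unique-resp-↭ (setoid A) (↭⇒↭ₛ σ)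

any-↭ : ∀ {A : Set} (f : A → Bool) {xs ys} → xs ↭ ys → any f xs ≡ any f ys
any-↭ f ↭.refl        = refl
any-↭ f (prep x σ)    = cong (f x ∨_) (any-↭ f σ)
any-↭ f (swap x y σ)  = trans (cong (λ r → f x ∨ (f y ∨ r)) (any-↭ f σ)) (∨-swap (f x) (f y) _)
  where
  ∨-swap : ∀ a b c → a ∨ (b ∨ c) ≡ b ∨ (a ∨ c)
  ∨-swap true  b c = sym (∨-zeroʳ b)
  ∨-swap false b c = refl
any-↭ f (↭.trans σ τ) = trans (any-↭ f σ) (any-↭ f τ)

lookup-injective : ∀ {A : Set} {xs : List A} → Unique xs → ∀ i j → lookup xs i ≡ lookup xs j → i ≡ j
lookup-injective (_  ∷ _) zero    zero    _ = refl
lookup-injective (x∉ ∷ _) zero    (suc j) e = contradiction e (All.lookup x∉ (∈-lookup j))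
lookup-injective (x∉ ∷ _) (suc i) zero    e = contradiction (sym e) (All.lookup x∉ (∈-lookup i))
lookup-injective (_  ∷ u) (suc i) (suc j) e = cong suc (lookup-injective u i j e)

linked-lookup : ∀ {A : Set} {R : A → A → Set} {xs : List A} → Linked R xs →
                ∀ i j → suc (toℕ i) ≡ toℕ j → R (lookup xs i) (lookup xs j)
linked-lookup (r ∷ _) zero    (suc zero) _ = r
linked-lookup (_ ∷ l) (suc i) (suc j)    e = linked-lookup l i j (Nat.suc-injective e)

module _ (G : Graph) where

  V : Set
  V = Fin (n G)

  adj-sym : ∀ {u v} → Adj G u v → Adj G v u
  adj-sym {u} {v} uv = trans (Graph.sym G v u) uv

  adj⇒≢ : ∀ {u v} → Adj G u v → u ≢ v
  adj⇒≢ {u} uu refl = case trans (sym uu) (irrefl G u) of λ ()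

  N[_] : V → V → Bool
  N[ x ] v = does (x ≟ v) ∨ adj G x v

  ∈N⁻ : ∀ {x v} → N[ x ] v ≡ true → x ≡ v ⊎ Adj G x v
  ∈N⁻ {x} {v} h with x ≟ v
  ... | yes x≡v = inj₁ x≡v
  ... | no  _   = inj₂ h

  ∈N-self : ∀ x → N[ x ] x ≡ true
  ∈N-self x = cong (_∨ adj G x x) (dec-true (x ≟ x) refl)

  ∈N-adj : ∀ {x v} → Adj G x v → N[ x ] v ≡ true
  ∈N-adj {x} {v} xv = trans (cong (does (x ≟ v) ∨_) xv) (∨-zeroʳ _)

  1+degree≤∣N∣ : ∀ x → suc (degree G x) ≤ count N[ x ]
  1+degree≤∣N∣ x = begin
    suc (degree G x)                              ≡⟨ cong suc degree≡count ⟩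
    1 + count (adj G x)                           ≤⟨ +-monoˡ-≤ _ (count-pos x (dec-true (x ≟ x) refl)) ⟩
    count (λ v → does (x ≟ v)) + count (adj G x)  ≤⟨ count-disjoint-∪ {p = λ v → does (x ≟ v)} loopless ⟩
    count N[ x ]                                  ∎
    where
    open ≤-Reasoning
    degree≡count : degree G x ≡ count (adj G x)
    degree≡count = trans (∣p∣≡count (Vec.tabulate (adj G x))) (count-cong (lookup∘tabulate (adj G x)))
    loopless : ∀ v → does (x ≟ v) ≡ true → adj G x v ≢ true
    loopless v x≡v xv = adj⇒≢ xv (does-≟⇒≡ x≡v)

  cycle : ∀ x xs → 2 ≤ length xs → Unique (x ∷ xs) → Linked (Adj G) (x ∷ xs) →
          Adj G (lookup (x ∷ xs) (fromℕ (length xs))) x → Cycle G (suc (length xs))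
  cycle x xs 2≤∣xs∣ distinct path closing = record
    { three≤k = s≤s 2≤∣xs∣
    ; walk    = lookup (x ∷ xs)
    ; inj     = lookup-injective distinct
    ; step    = linked-lookup path
    ; close   = λ i j i-last j-first →
        subst₂ (λ u v → Adj G (lookup (x ∷ xs) u) (lookup (x ∷ xs) v)) (last i-last) (first j-first) closing
    }
    where
    last : ∀ {i} → suc (toℕ i) ≡ suc (length xs) → fromℕ (length xs) ≡ i
    last e = toℕ-injective (trans (toℕ-fromℕ _) (sym (Nat.suc-injective e)))
    first : ∀ {j : Fin (suc (length xs))} → toℕ j ≡ 0 → zero ≡ j
    first e = toℕ-injective (sym e)

  no-triangle : ¬ Cycle G 3 → ∀ {a b c} → Adj G a b → Adj G b c → Adj G c a → ⊥
  no-triangle no3 ab bc ca = no3 (cycle _ (_ ∷ _ ∷ []) (s≤s (s≤s z≤n))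
    (distinct₃ (adj⇒≢ ab) (≢-sym (adj⇒≢ ca)) (adj⇒≢ bc)) (ab ∷ bc ∷ [-]) ca)

  no-square : ¬ Cycle G 4 → ∀ {a b c d} → Adj G a b → Adj G b c → Adj G c d → Adj G d a →
              a ≢ c → b ≢ d → ⊥
  no-square no4 ab bc cd da a≢c b≢d = no4 (cycle _ (_ ∷ _ ∷ _ ∷ []) (s≤s (s≤s z≤n))
    (distinct₄ (adj⇒≢ ab) a≢c (≢-sym (adj⇒≢ da)) (adj⇒≢ bc) b≢d (adj⇒≢ cd)) (ab ∷ bc ∷ cd ∷ [-]) da)

  no-pentagon : ¬ Cycle G 5 → ∀ {a b c d e} →
                Adj G a b → Adj G b c → Adj G c d → Adj G d e → Adj G e a →
                a ≢ c → a ≢ d → b ≢ d → b ≢ e → c ≢ e → ⊥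
  no-pentagon no5 ab bc cd de ea a≢c a≢d b≢d b≢e c≢e = no5 (cycle _ (_ ∷ _ ∷ _ ∷ _ ∷ []) (s≤s (s≤s z≤n))
    ((adj⇒≢ ab ∷ a≢c ∷ a≢d ∷ ≢-sym (adj⇒≢ ea) ∷ []) ∷ (adj⇒≢ bc ∷ b≢d ∷ b≢e ∷ []) ∷
     (adj⇒≢ cd ∷ c≢e ∷ []) ∷ (adj⇒≢ de ∷ []) ∷ [] ∷ [])
    (ab ∷ bc ∷ cd ∷ de ∷ [-]) ea)

  common₂ : V → V → ℕ
  common₂ u v = count (λ z → N[ u ] z ∧ N[ v ] z)

  common₃ : V → V → V → ℕ
  common₃ u v w = count (λ z → N[ u ] z ∧ N[ v ] z ∧ N[ w ] z)

  common₄ : V → V → V → V → ℕ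
  common₄ u v w x = count (λ z → N[ u ] z ∧ N[ v ] z ∧ N[ w ] z ∧ N[ x ] z)

  common-neighbour : ∀ {u v z} → u ≢ v → ¬ Adj G u v → N[ u ] z ∧ N[ v ] z ≡ true → Adj G u z × Adj G v z
  common-neighbour {u} {v} {z} u≢v ¬uv h with ∧-true⁻ {N[ u ] z} h
  ... | uz , vz with ∈N⁻ {u} uz | ∈N⁻ {v} vz
  ... | inj₁ refl | inj₁ refl = contradiction refl u≢v
  ... | inj₁ refl | inj₂ vu   = contradiction (adj-sym vu) ¬uv
  ... | inj₂ uz′  | inj₁ refl = contradiction uz′ ¬uv
  ... | inj₂ uz′  | inj₂ vz′  = uz′ , vz′

  common₃-pos : ∀ {u v w z} → N[ u ] z ≡ true → N[ v ] z ≡ true → N[ w ] z ≡ true → 1 ≤ common₃ u v w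
  common₃-pos {z = z} uz vz wz = count-pos z (∧-true⁺ uz (∧-true⁺ vz wz))

  common₄≤common₃-abc : ∀ {a b c d} → common₄ a b c d ≤ common₃ a b c
  common₄≤common₃-abc {a} {b} {c} {d} = count-mono drop-d
    where
    drop-d : ∀ z → N[ a ] z ∧ N[ b ] z ∧ N[ c ] z ∧ N[ d ] z ≡ true → N[ a ] z ∧ N[ b ] z ∧ N[ c ] z ≡ true
    drop-d z h with ∧-true⁻ {N[ a ] z} h
    ... | az , bcd with ∧-true⁻ {N[ b ] z} bcd
    ... | bz , cd = ∧-true⁺ az (∧-true⁺ bz (proj₁ (∧-true⁻ cd)))

  common₄≤common₃-abd : ∀ {a b c d} → common₄ a b c d ≤ common₃ a b d
  common₄≤common₃-abd {a} {b} {c} {d} = count-mono drop-c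
    where
    drop-c : ∀ z → N[ a ] z ∧ N[ b ] z ∧ N[ c ] z ∧ N[ d ] z ≡ true → N[ a ] z ∧ N[ b ] z ∧ N[ d ] z ≡ true
    drop-c z h with ∧-true⁻ {N[ a ] z} h
    ... | az , bcd with ∧-true⁻ {N[ b ] z} bcd
    ... | bz , cd = ∧-true⁺ az (∧-true⁺ bz (proj₂ (∧-true⁻ {N[ c ] z} cd)))

  -- Overlapping closed neighbourhoods

  ⋃N : List V → V → Bool
  ⋃N xs v = any (λ x → N[ x ] v) xs

  Overlap≤ : List V → ℕ → Set
  Overlap≤ xs ℓ = sum (map (λ x → count N[ x ]) xs) ≤ count (⋃N xs) + ℓ

  overlap-↭ : ∀ {xs ys ℓ} → xs ↭ ys → Overlap≤ xs ℓ → Overlap≤ ys ℓ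
  overlap-↭ {xs} {ys} {ℓ} σ bound = begin
    sum (map (λ x → count N[ x ]) ys)  ≡⟨ sum-↭ (map⁺ (λ x → count N[ x ]) (↭-sym σ)) ⟩
    sum (map (λ x → count N[ x ]) xs)  ≤⟨ bound ⟩
    count (⋃N xs) + ℓ                  ≡⟨ cong (_+ ℓ) (count-cong (λ v → any-↭ (λ x → N[ x ] v) σ)) ⟩
    count (⋃N ys) + ℓ                  ∎
    where open ≤-Reasoning

  wlog : ∀ {xs ys ℓ} → ys ↭ xs → (Unique ys → Overlap≤ ys ℓ) → Unique xs → Overlap≤ xs ℓ
  wlog σ bound distinct = overlap-↭ σ (bound (unique-↭ (↭-sym σ) distinct))

  overlap₃ : ∀ {a b c} → common₂ a b + common₂ a c + common₂ b c ≤ 4 + common₃ a b c →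
             Overlap≤ (a ∷ b ∷ c ∷ []) 4
  overlap₃ {a} {b} {c} = count-⋃₃ N[ a ] N[ b ] N[ c ] 4

  pairs₄ : V → V → V → V → ℕ
  pairs₄ a b c d = common₂ a b + common₂ a c + common₂ a d + common₂ b c + common₂ b d + common₂ c d

  triples₄ : V → V → V → V → ℕ
  triples₄ a b c d = common₃ a b c + common₃ a b d + common₃ a c d + common₃ b c d

  overlap₄ : ∀ {a b c d} → pairs₄ a b c d + common₄ a b c d ≤ 6 + triples₄ a b c d →
             Overlap≤ (a ∷ b ∷ c ∷ d ∷ []) 6
  overlap₄ {a} {b} {c} {d} = count-⋃₄ N[ a ] N[ b ] N[ c ] N[ d ] 6

  overlap₄-via-abc : ∀ {a b c d} → pairs₄ a b c d ≤ 6 + (common₃ a b d + common₃ a c d + common₃ b c d) →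
                     Overlap≤ (a ∷ b ∷ c ∷ d ∷ []) 6
  overlap₄-via-abc {a} {b} {c} {d} pairs≤ = overlap₄
    (absorb-first {ℓ = 6} (common₃ a b c) (common₃ a b d) (common₃ a c d) (common₃ b c d)
                  pairs≤ (common₄≤common₃-abc {a} {b} {c} {d}))

  overlap₄-via-abd : ∀ {a b c d} → pairs₄ a b c d ≤ 6 + (common₃ a b c + common₃ a c d + common₃ b c d) →
                     Overlap≤ (a ∷ b ∷ c ∷ d ∷ []) 6
  overlap₄-via-abd {a} {b} {c} {d} pairs≤ = overlap₄
    (absorb-second {ℓ = 6} (common₃ a b c) (common₃ a b d) (common₃ a c d) (common₃ b c d)
                   pairs≤ (common₄≤common₃-abd {a} {b} {c} {d}))

  pairs₄-around-edge : ∀ {a b c d x y z w} → common₂ a b ≤ x → common₂ a c + common₂ b c ≤ y →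
                       common₂ a d + common₂ b d ≤ z → common₂ c d ≤ w → pairs₄ a b c d ≤ x + y + z + w
  pairs₄-around-edge {a} {b} {c} {d} ab≤ c≤ d≤ cd≤ = ≤-trans
    (≤-reflexive (regroup (common₂ a b) (common₂ a c) (common₂ a d) (common₂ b c) (common₂ b d) (common₂ c d)))
    (+-mono-≤ (+-mono₃-≤ ab≤ c≤ d≤) cd≤)
    where
    regroup : ∀ ab ac ad bc bd cd → ab + ac + ad + bc + bd + cd ≡ ab + (ac + bc) + (ad + bd) + cd
    regroup = solve-∀

  -- Girth at least five

  module _ (no3 : ¬ Cycle G 3) where

    adjacent-common≤2 : ∀ {u v} → Adj G u v → common₂ u v ≤ 2
    adjacent-common≤2 {u} {v} uv = count-≤2 u v ends
      where
      ends : ∀ z → N[ u ] z ∧ N[ v ] z ≡ true → z ≡ u ⊎ z ≡ v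
      ends z h with ∧-true⁻ {N[ u ] z} h
      ... | uz , vz with ∈N⁻ {u} uz | ∈N⁻ {v} vz
      ... | inj₁ u≡z | _        = inj₁ (sym u≡z)
      ... | inj₂ _   | inj₁ v≡z = inj₂ (sym v≡z)
      ... | inj₂ uz′ | inj₂ vz′ = ⊥-elim (no-triangle no3 uv vz′ (adj-sym uz′))

    module _ (no4 : ¬ Cycle G 4) where

      nonadjacent-common≤1 : ∀ {u v} → u ≢ v → ¬ Adj G u v → common₂ u v ≤ 1
      nonadjacent-common≤1 {u} {v} u≢v ¬uv = count-≤1 unique
        where
        unique : ∀ z z′ → N[ u ] z ∧ N[ v ] z ≡ true → N[ u ] z′ ∧ N[ v ] z′ ≡ true → z ≡ z′
        unique z z′ hz hz′ with common-neighbour u≢v ¬uv hz | common-neighbour u≢v ¬uv hz′ | z ≟ z′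
        ... | _       | _         | yes z≡z′ = z≡z′
        ... | uz , vz | uz′ , vz′ | no z≢z′  =
              ⊥-elim (no-square no4 uz (adj-sym vz) vz′ (adj-sym uz′) u≢v z≢z′)

      overlap-girth5 : ∀ {a b c} → Unique (a ∷ b ∷ c ∷ []) → Overlap≤ (a ∷ b ∷ c ∷ []) 4
      overlap-girth5 {a} {b} {c} (distinct₃ a≢b a≢c b≢c) = overlap₃ pairs≤
        where
        edge : ∀ {u v} → adj G u v ≡ true → common₂ u v ≤ 2
        edge = adjacent-common≤2
        non-edge : ∀ {u v} → u ≢ v → adj G u v ≡ false → common₂ u v ≤ 1
        non-edge u≢v uv = nonadjacent-common≤1 u≢v (not-¬ uv)
        centred : ∀ {P T} → P ≤ 5 → 1 ≤ T → P ≤ 4 + T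
        centred P≤5 1≤T = ≤-trans P≤5 (+-monoʳ-≤ 4 1≤T)
        uncentred : ∀ {P T} → P ≤ 4 → P ≤ 4 + T
        uncentred P≤4 = ≤-trans P≤4 (m≤m+n 4 _)

        pairs≤ : common₂ a b + common₂ a c + common₂ b c ≤ 4 + common₃ a b c
        pairs≤ with adj G a b in ab | adj G a c in ac | adj G b c in bc
        ... | true  | true  | true  = ⊥-elim (no-triangle no3 ab bc (adj-sym ac))
        ... | true  | true  | false = centred (+-mono₃-≤ (edge ab) (edge ac) (non-edge b≢c bc))
                                              (common₃-pos (∈N-self a) (∈N-adj (adj-sym ab)) (∈N-adj (adj-sym ac)))
        ... | true  | false | true  = centred (+-mono₃-≤ (edge ab) (non-edge a≢c ac) (edge bc))
                                              (common₃-pos (∈N-adj ab) (∈N-self b) (∈N-adj (adj-sym bc)))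
        ... | false | true  | true  = centred (+-mono₃-≤ (non-edge a≢b ab) (edge ac) (edge bc))
                                              (common₃-pos (∈N-adj ac) (∈N-adj bc) (∈N-self c))
        ... | true  | false | false = uncentred (+-mono₃-≤ (edge ab) (non-edge a≢c ac) (non-edge b≢c bc))
        ... | false | true  | false = uncentred (+-mono₃-≤ (non-edge a≢b ab) (edge ac) (non-edge b≢c bc))
        ... | false | false | true  = uncentred (+-mono₃-≤ (non-edge a≢b ab) (non-edge a≢c ac) (edge bc))
        ... | false | false | false =
              uncentred (≤-trans (+-mono₃-≤ (non-edge a≢b ab) (non-edge a≢c ac) (non-edge b≢c bc)) (n≤1+n 3))

      -- Girth at least six

      module _ (no5 : ¬ Cycle G 5) where

        edge-side-common≤1 : ∀ {u v w} → Adj G u v → u ≢ w → v ≢ w → ¬ Adj G u w → ¬ Adj G v w →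
                             common₂ u w + common₂ v w ≤ 1
        edge-side-common≤1 {u} {v} {w} uv u≢w v≢w ¬uw ¬vw =
          count-+-≤1 (nonadjacent-common≤1 u≢w ¬uw) (nonadjacent-common≤1 v≢w ¬vw) apart
          where
          apart : ∀ i j → N[ u ] i ∧ N[ w ] i ≡ true → N[ v ] j ∧ N[ w ] j ≡ true → ⊥
          apart i j hi hj with common-neighbour u≢w ¬uw hi | common-neighbour v≢w ¬vw hj | i ≟ j
          ... | ui , _  | vj , _  | yes refl = no-triangle no3 uv vj (adj-sym ui)
          ... | ui , wi | vj , wj | no i≢j   =
                no-pentagon no5 uv vj (adj-sym wj) wi (adj-sym ui) u≢j u≢w v≢w v≢i (≢-sym i≢j)
            where
            u≢j : u ≢ j
            u≢j refl = ¬uw (adj-sym wj)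
            v≢i : v ≢ i
            v≢i refl = ¬vw (adj-sym wi)

        path-ends-common≡0 : ∀ {x y z w} → Adj G x y → Adj G y z → Adj G z w → x ≢ z → y ≢ w → x ≢ w →
                             common₂ x w ≡ 0
        path-ends-common≡0 {x} {y} {z} {w} xy yz zw x≢z y≢w x≢w = count-≡0 none
          where
          ¬xw : ¬ Adj G x w
          ¬xw xw = no-square no4 xy yz zw (adj-sym xw) x≢z y≢w
          none : ∀ t → N[ x ] t ∧ N[ w ] t ≢ true
          none t h with common-neighbour x≢w ¬xw h | t ≟ y | t ≟ z
          ... | _ , wt  | yes refl | _        = no-triangle no3 yz zw wt
          ... | xt , _  | no _     | yes refl = no-triangle no3 xy yz (adj-sym xt)
          ... | xt , wt | no t≢y   | no t≢z   =
                no-pentagon no5 xy yz zw wt (adj-sym xt) x≢z x≢w y≢w (≢-sym t≢y) (≢-sym t≢z)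

        independent : ∀ {a b c d} → ¬ Adj G a b → ¬ Adj G a c → ¬ Adj G a d → ¬ Adj G b c → ¬ Adj G b d →
                      ¬ Adj G c d → Unique (a ∷ b ∷ c ∷ d ∷ []) → Overlap≤ (a ∷ b ∷ c ∷ d ∷ []) 6
        independent ¬ab ¬ac ¬ad ¬bc ¬bd ¬cd (distinct₄ a≢b a≢c a≢d b≢c b≢d c≢d) = overlap₄-via-abc (≤-trans
          (+-mono₆-≤ (nonadjacent-common≤1 a≢b ¬ab) (nonadjacent-common≤1 a≢c ¬ac) (nonadjacent-common≤1 a≢d ¬ad)
                     (nonadjacent-common≤1 b≢c ¬bc) (nonadjacent-common≤1 b≢d ¬bd) (nonadjacent-common≤1 c≢d ¬cd))
          (m≤m+n 6 _))

        one-edge : ∀ {a b c d} → Adj G a b → ¬ Adj G a c → ¬ Adj G b c → ¬ Adj G a d → ¬ Adj G b d →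
                   ¬ Adj G c d → Unique (a ∷ b ∷ c ∷ d ∷ []) → Overlap≤ (a ∷ b ∷ c ∷ d ∷ []) 6
        one-edge {a} {b} {c} {d} ab ¬ac ¬bc ¬ad ¬bd ¬cd (distinct₄ _ a≢c a≢d b≢c b≢d c≢d) = overlap₄-via-abc (≤-trans
          (pairs₄-around-edge {a} {b} {c} {d}
            (adjacent-common≤2 ab) (edge-side-common≤1 ab a≢c b≢c ¬ac ¬bc)
            (edge-side-common≤1 ab a≢d b≢d ¬ad ¬bd) (nonadjacent-common≤1 c≢d ¬cd))
          (≤-trans (n≤1+n 5) (m≤m+n 6 _)))

        two-edges : ∀ {a b c d} → Adj G a b → Adj G c d → ¬ Adj G a c → ¬ Adj G b c → ¬ Adj G a d →
                    ¬ Adj G b d → Unique (a ∷ b ∷ c ∷ d ∷ []) → Overlap≤ (a ∷ b ∷ c ∷ d ∷ []) 6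
        two-edges {a} {b} {c} {d} ab cd ¬ac ¬bc ¬ad ¬bd (distinct₄ _ a≢c a≢d b≢c b≢d _) = overlap₄-via-abc (≤-trans
          (pairs₄-around-edge {a} {b} {c} {d}
            (adjacent-common≤2 ab) (edge-side-common≤1 ab a≢c b≢c ¬ac ¬bc)
            (edge-side-common≤1 ab a≢d b≢d ¬ad ¬bd) (adjacent-common≤2 cd))
          (m≤m+n 6 _))

        path-and-point : ∀ {a b c d} → Adj G a b → Adj G b c → ¬ Adj G a d → ¬ Adj G b d → ¬ Adj G c d →
                         Unique (a ∷ b ∷ c ∷ d ∷ []) → Overlap≤ (a ∷ b ∷ c ∷ d ∷ []) 6
        path-and-point {a} {b} {c} {d} ab bc ¬ad ¬bd ¬cd (distinct₄ _ a≢c a≢d _ b≢d c≢d) = overlap₄-via-abd (≤-trans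
          (pairs₄-around-edge {a} {b} {c} {d}
            (adjacent-common≤2 ab)
            (+-mono-≤ (nonadjacent-common≤1 a≢c (λ ac → no-triangle no3 ab bc (adj-sym ac))) (adjacent-common≤2 bc))
            (edge-side-common≤1 ab a≢d b≢d ¬ad ¬bd) (nonadjacent-common≤1 c≢d ¬cd))
          (+-monoʳ-≤ 6 (+-mono₃-≤ (common₃-pos (∈N-adj ab) (∈N-self b) (∈N-adj (adj-sym bc))) z≤n z≤n)))

        path : ∀ {a b c d} → Adj G a b → Adj G b c → Adj G c d →
               Unique (a ∷ b ∷ c ∷ d ∷ []) → Overlap≤ (a ∷ b ∷ c ∷ d ∷ []) 6
        path {a} {b} {c} {d} ab bc cd (distinct₄ _ a≢c a≢d _ b≢d _) = overlap₄-via-abd (≤-trans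
          (+-mono₆-≤ (adjacent-common≤2 ab) (nonadjacent-common≤1 a≢c (λ ac → no-triangle no3 ab bc (adj-sym ac)))
                     (≤-reflexive (path-ends-common≡0 ab bc cd a≢c b≢d a≢d)) (adjacent-common≤2 bc)
                     (nonadjacent-common≤1 b≢d (λ bd → no-triangle no3 bc cd (adj-sym bd))) (adjacent-common≤2 cd))
          (+-monoʳ-≤ 6 (+-mono₃-≤ (common₃-pos (∈N-adj ab) (∈N-self b) (∈N-adj (adj-sym bc))) z≤n
                                  (common₃-pos (∈N-adj bc) (∈N-self c) (∈N-adj (adj-sym cd))))))

        star : ∀ {a b c d} → Adj G a b → Adj G a c → Adj G a d →
               Unique (a ∷ b ∷ c ∷ d ∷ []) → Overlap≤ (a ∷ b ∷ c ∷ d ∷ []) 6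
        star {a} {b} {c} {d} ab ac ad (distinct₄ _ _ _ b≢c b≢d c≢d) = overlap₄-via-abc (≤-trans
          (+-mono₆-≤ (adjacent-common≤2 ab) (adjacent-common≤2 ac) (adjacent-common≤2 ad)
                     (nonadjacent-common≤1 b≢c (λ bc → no-triangle no3 ab bc (adj-sym ac)))
                     (nonadjacent-common≤1 b≢d (λ bd → no-triangle no3 ab bd (adj-sym ad)))
                     (nonadjacent-common≤1 c≢d (λ cd → no-triangle no3 ac cd (adj-sym ad))))
          (+-monoʳ-≤ 6 (+-mono₃-≤ (common₃-pos (∈N-self a) (a∈N ab) (a∈N ad))
                                  (common₃-pos (∈N-self a) (a∈N ac) (a∈N ad))
                                  (common₃-pos (a∈N ab) (a∈N ac) (a∈N ad)))))
          where
          a∈N : ∀ {x} → Adj G a x → N[ x ] a ≡ true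
          a∈N ax = ∈N-adj (adj-sym ax)

        -- With girth six G is a forest on {a, b, c, d}; up to relabelling it is one of the six
        -- shapes above, and `wlog` transports the bound back from the relabelled list.

        from-path : ∀ {a b c d} → Adj G a b → Adj G b c →
                    Unique (a ∷ b ∷ c ∷ d ∷ []) → Overlap≤ (a ∷ b ∷ c ∷ d ∷ []) 6
        from-path {a} {b} {c} {d} ab bc with adj G b d in bd | adj G c d in cd | adj G a d in ad
        ... | true  | _     | _     = wlog (swap b a ↭.refl) (star (adj-sym ab) bc bd)
        ... | false | true  | _     = path ab bc cd
        ... | false | false | true  = wlog (shifts (d ∷ []) (a ∷ b ∷ c ∷ [])) (path (adj-sym ad) ab bc)
        ... | false | false | false = path-and-point ab bc (not-¬ ad) (not-¬ bd) (not-¬ cd)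

        from-edge : ∀ {a b c d} → Adj G a b → Unique (a ∷ b ∷ c ∷ d ∷ []) → Overlap≤ (a ∷ b ∷ c ∷ d ∷ []) 6
        from-edge {a} {b} {c} {d} ab with adj G b c in bc | adj G a c in ac | adj G b d in bd | adj G a d in ad
        ... | true  | _     | _     | _     = from-path ab bc
        ... | false | true  | _     | _     = wlog (swap b a ↭.refl) (from-path (adj-sym ab) ac)
        ... | false | false | true  | _     = wlog (prep a (prep b (swap d c ↭.refl))) (from-path ab bd)
        ... | false | false | false | true  = wlog (swap b a (swap d c ↭.refl)) (from-path (adj-sym ab) ad)
        ... | false | false | false | false with adj G c d in cd
        ...   | true  = two-edges ab cd (not-¬ ac) (not-¬ bc) (not-¬ ad) (not-¬ bd)
        ...   | false = one-edge ab (not-¬ ac) (not-¬ bc) (not-¬ ad) (not-¬ bd) (not-¬ cd)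

        overlap-girth6 : ∀ {a b c d} → Unique (a ∷ b ∷ c ∷ d ∷ []) → Overlap≤ (a ∷ b ∷ c ∷ d ∷ []) 6
        overlap-girth6 {a} {b} {c} {d}
          with adj G a b in ab | adj G a c in ac | adj G a d in ad | adj G b c in bc | adj G b d in bd
             | adj G c d in cd
        ... | true  | _     | _     | _     | _     | _     = from-edge ab
        ... | false | true  | _     | _     | _     | _     = wlog (prep a (swap c b ↭.refl)) (from-edge ac)
        ... | false | false | true  | _     | _     | _     = wlog (prep a (shifts (d ∷ []) (b ∷ c ∷ []))) (from-edge ad)
        ... | false | false | false | true  | _     | _     = wlog (shifts (b ∷ c ∷ []) (a ∷ [])) (from-edge bc)
        ... | false | false | false | false | true  | _     =
              wlog (↭.trans (shifts (b ∷ d ∷ []) (a ∷ [])) (prep a (prep b (swap d c ↭.refl)))) (from-edge bd)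
        ... | false | false | false | false | false | true  = wlog (shifts (c ∷ d ∷ []) (a ∷ b ∷ [])) (from-edge cd)
        ... | false | false | false | false | false | false =
              independent (not-¬ ab) (not-¬ ac) (not-¬ ad) (not-¬ bc) (not-¬ bd) (not-¬ cd)

  -- Zero forcing

  closure-mono : ∀ {S S′ u} → S ⊆ S′ → InClosure G S u → InClosure G S′ u
  closure-mono S⊆S′ (base u∈S)               = base (S⊆S′ u∈S)
  closure-mono S⊆S′ (force v v∈F vu others) =
    force v (closure-mono S⊆S′ v∈F) vu (λ w vw w≢u → closure-mono S⊆S′ (others w vw w≢u))

  record Force (S : Subset (n G)) (x y : V) : Set where
    field
      forcer : x ∈ S
      edge   : Adj G x y
      target : y ∉ S
      others : ∀ w → Adj G x w → w ≢ y → w ∈ S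

  force-from-closure : ∀ {S u} → InClosure G S u → u ∉ S → ∃₂ (Force S)
  force-from-closure (base u∈S) u∉S = contradiction u∈S u∉S
  force-from-closure {S} {u} (force v v∈F vu others) u∉S with v ∈? S
  ... | no v∉S = force-from-closure v∈F v∉S
  ... | yes v∈S with any? (λ w → (adj G v w ≟ᵇ true) ×-dec ¬? (w ≟ u) ×-dec ¬? (w ∈? S))
  ...   | yes (w , vw , w≢u , w∉S) = force-from-closure (others w vw w≢u) w∉S
  ...   | no  none = v , u , record
          { forcer = v∈S
          ; edge   = vu
          ; target = u∉S
          ; others = λ w vw w≢u → decidable-stable (w ∈? S) (λ w∉S → none (w , vw , w≢u , w∉S))
          }

  complete-or-force : ∀ {S} → (∀ u → InClosure G S u) → (∀ u → u ∈ S) ⊎ ∃₂ (Force S)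
  complete-or-force {S} zf with all? (_∈? S)
  ... | yes complete = inj₁ complete
  ... | no incomplete =
        let u , u∉S = ¬∀⟶∃¬ _ _ (_∈? S) incomplete in inj₂ (force-from-closure (zf u) u∉S)

  Covered : Subset (n G) → V → Set
  Covered S x = ∀ v → N[ x ] v ≡ true → v ∈ S

  force-covers : ∀ {S x y} → Force S x y → Covered (S ∪ ⁅ y ⁆) x
  force-covers {y = y} F v xv with ∈N⁻ xv | v ≟ y
  ... | inj₁ refl | _        = x∈p∪q⁺ (inj₁ (Force.forcer F))
  ... | inj₂ _    | yes refl = x∈p∪q⁺ (inj₂ (x∈⁅x⁆ y))
  ... | inj₂ xv′  | no v≢y   = x∈p∪q⁺ (inj₁ (Force.others F v xv′ v≢y))

  -- A vertex that forces later has a neighbour outside the current set, so it differs from every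
  -- earlier forcer, whose closed neighbourhood is already inside that set.

  Escapes : Subset (n G) → V → Set
  Escapes S x = ∃ λ w → Adj G x w × w ∉ S

  record Run (S : Subset (n G)) (k : ℕ) : Set where
    field
      final   : Subset (n G)
      size    : ∣ final ∣ ≤ k + ∣ S ∣
      grows   : S ⊆ final
      outcome : (∀ v → v ∈ final) ⊎
                Σ (List V) λ xs → Unique xs × length xs ≡ k × All (λ x → Covered final x × Escapes S x) xs

  run : ∀ k S → (∀ u → InClosure G S u) → Run S k
  run zero    S zf = record { final = S ; size = ≤-refl ; grows = id ; outcome = inj₂ ([] , [] , refl , []) }
  run (suc k) S zf with complete-or-force zf
  ... | inj₁ complete = record { final = S ; size = m≤n+m ∣ S ∣ (suc k) ; grows = id ; outcome = inj₁ complete }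
  ... | inj₂ (x , y , F) = extend (run k (S ∪ ⁅ y ⁆) (λ u → closure-mono S⊆S′ (zf u)))
    where
    S⊆S′ : S ⊆ S ∪ ⁅ y ⁆
    S⊆S′ = p⊆p∪q ⁅ y ⁆
    extend : Run (S ∪ ⁅ y ⁆) k → Run S (suc k)
    extend R = record
      { final   = final
      ; size    = begin
          ∣ final ∣               ≤⟨ size ⟩
          k + ∣ S ∪ ⁅ y ⁆ ∣       ≤⟨ +-monoʳ-≤ k (∣p∪q∣≤∣p∣+∣q∣ S ⁅ y ⁆) ⟩
          k + (∣ S ∣ + ∣ ⁅ y ⁆ ∣)  ≡⟨ cong (λ m → k + (∣ S ∣ + m)) (∣⁅x⁆∣≡1 y) ⟩
          k + (∣ S ∣ + 1)         ≡⟨ trans (cong (k +_) (Nat.+-comm ∣ S ∣ 1)) (+-suc k ∣ S ∣) ⟩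
          suc k + ∣ S ∣           ∎
      ; grows   = grows ∘ S⊆S′
      ; outcome = ⊎.map₂ prepend-forcer outcome
      }
      where
      open Run R
      open ≤-Reasoning
      prepend-forcer :
        Σ (List V) (λ xs → Unique xs × length xs ≡ k × All (λ x → Covered final x × Escapes (S ∪ ⁅ y ⁆) x) xs) →
        Σ (List V) (λ xs → Unique xs × length xs ≡ suc k × All (λ x → Covered final x × Escapes S x) xs)
      prepend-forcer (xs , distinct , len , later) =
        x ∷ xs , All.map x≢ later ∷ distinct , cong suc len ,
        ((λ v xv → grows (force-covers F v xv)) , (y , Force.edge F , Force.target F)) ∷
        All.map (λ { (covered , w , x′w , w∉) → covered , w , x′w , w∉ ∘ S⊆S′ }) later
        where
        x≢ : ∀ {x′} → Covered final x′ × Escapes (S ∪ ⁅ y ⁆) x′ → x ≢ x′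
        x≢ (_ , w , x′w , w∉) refl = w∉ (force-covers F w (∈N-adj x′w))

  forcers-covered : ∀ {Z} → IsZeroForcingSet G Z → ∀ ws → Unique ws →
    Σ (Subset (n G)) λ S → ∣ S ∣ ≤ length ws + ∣ Z ∣ ×
      Σ (List V) λ xs → Unique xs × length xs ≡ length ws × All (Covered S) xs
  forcers-covered {Z} zf ws distinct with run (length ws) Z zf
  ... | record { final = S ; size = size ; outcome = inj₁ complete } =
        S , size , ws , distinct , refl , All.universal (λ _ v _ → complete v) ws
  ... | record { final = S ; size = size ; outcome = inj₂ (xs , distinct′ , len , forcers) } =
        S , size , xs , distinct′ , len , All.map proj₁ forcers

  ⋃N-covered : ∀ {S} xs → All (Covered S) xs → ∀ v → ⋃N xs v ≡ true → v ∈ S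
  ⋃N-covered (x ∷ xs) (x-covered ∷ xs-covered) v h with N[ x ] v in xv
  ... | true  = x-covered v xv
  ... | false = ⋃N-covered xs xs-covered v h

  zero-forcing-bound : ∀ {j d} (ws : List V) → Unique ws → length ws ≡ suc j →
    (∀ v → 2 + d ≤ degree G v) → (∀ xs → Unique xs → length xs ≡ suc j → Overlap≤ xs (2 * j)) →
    ZeroForcingNumber≥ G (suc j * d + 2)
  zero-forcing-bound {j} {d} ws distinct len min-degree overlap-bound Z zf with forcers-covered zf ws distinct
  ... | S , ∣S∣≤ , xs , distinct′ , len′ , covered = bound-from-counts j d ∣ Z ∣ (begin
    suc j * (3 + d)                    ≡⟨ cong (_* (3 + d)) (trans len′ len) ⟨
    length xs * (3 + d)                ≤⟨ length*≤sum xs (λ x → ≤-trans (s≤s (min-degree x)) (1+degree≤∣N∣ x)) ⟩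
    sum (map (λ x → count N[ x ]) xs)  ≤⟨ overlap-bound xs distinct′ (trans len′ len) ⟩
    count (⋃N xs) + 2 * j              ≤⟨ +-monoˡ-≤ (2 * j) (count≤∣S∣ S (⋃N-covered xs covered)) ⟩
    ∣ S ∣ + 2 * j                      ≤⟨ +-monoˡ-≤ (2 * j) ∣S∣≤ ⟩
    length ws + ∣ Z ∣ + 2 * j          ≡⟨ cong (λ k → k + ∣ Z ∣ + 2 * j) len ⟩
    suc j + ∣ Z ∣ + 2 * j              ∎)
    where open ≤-Reasoning

  -- g − 2 distinct vertices, needed when forcing completes in fewer than g − 2 steps

  cycle-vertices : ∀ {g} → Cycle G g → List V
  cycle-vertices C = drop 2 (tabulate (Cycle.walk C))

  cycle-vertices-unique : ∀ {g} (C : Cycle G g) → Unique (cycle-vertices C)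
  cycle-vertices-unique C = drop⁺ 2 (tabulate⁺ (Cycle.inj C _ _))

theorem4 : (G : Graph) (g δ : ℕ) → HasGirth G g → (g ≡ 5 ⊎ g ≡ 6)
    → IsMinDegree G δ → 2 ≤ δ
    → ZeroForcingNumber≥ G ((g ∸ 2) * (δ ∸ 2) + 2)
theorem4 G .5 (suc (suc d)) (C , short) (inj₁ refl) (min-degree , _) (s≤s (s≤s z≤n)) =
  zero-forcing-bound G (cycle-vertices G C) (cycle-vertices-unique G C) refl min-degree triples
  where
  triples : ∀ xs → Unique xs → length xs ≡ 3 → Overlap≤ G xs 4
  triples (_ ∷ _ ∷ _ ∷ []) distinct _ =
    overlap-girth5 G (short 3 (≤ᵇ⇒≤ 4 5 tt)) (short 4 (≤ᵇ⇒≤ 5 5 tt)) distinct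
theorem4 G .6 (suc (suc d)) (C , short) (inj₂ refl) (min-degree , _) (s≤s (s≤s z≤n)) =
  zero-forcing-bound G (cycle-vertices G C) (cycle-vertices-unique G C) refl min-degree quadruples
  where
  quadruples : ∀ xs → Unique xs → length xs ≡ 4 → Overlap≤ G xs 6
  quadruples (_ ∷ _ ∷ _ ∷ _ ∷ []) distinct _ =
    overlap-girth6 G (short 3 (≤ᵇ⇒≤ 4 6 tt)) (short 4 (≤ᵇ⇒≤ 5 6 tt)) (short 5 (≤ᵇ⇒≤ 6 6 tt)) distinct
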